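{- Let $A$ be a natural number and let $\ell$ be a prime. Then the three numbers $A$, $A-4\ell$, $A-8\ell$ cannot all be squares in $\mathbb{Z}$. -}

module Defs where

-- Everything reduces to one arithmetic fact, the gap lemma: if two natural
-- squares differ by 4ℓ, say a² = b² + 4ℓ, then b = ℓ - 1.  Writing a = b + d,
-- the hypothesis reads d(2b + d) = 4ℓ.  Reducing mod 2 forces d to be even,
-- d = 2e, so e(b + e) = ℓ; the smaller factor e of the prime ℓ must be 1, and
-- b + 1 = ℓ.
module Submission where

open import Defs
open import Data.Nat using (ℕ)
open import Data.Nat.Primality using (Prime)
open import Data.Integer using (ℤ; +_; _-_; _*_)
open import Data.Product using (Σ; _×_)
open import Relation.Nullary using (¬_)
open import Relation.Binary.PropositionalEquality using (_≡_)

open import Data.Nat as ℕ using (zero; suc; _≤_; z≤n; s≤s; parity)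
import Data.Nat.Properties as ℕP
import Data.Integer as ℤ
import Data.Integer.Properties as ℤP
open import Algebra.Properties.AbelianGroup ℤP.+-0-abelianGroup using (//-rightDividesˡ)
open import Data.Nat.Primality using (prime⇒irreducible; prime⇒nonZero; ¬prime[0]; ¬prime[1])
open import Data.Nat.Divisibility using (divides)
open import Data.Nat.Solver using (module +-*-Solver)
open import Data.Parity using (Parity; 0ℙ) renaming (_*_ to _ℙ*_; _+_ to _ℙ+_)
import Data.Parity.Properties as ℙP
open import Data.Product using (_,_; ∃; proj₁; proj₂)
open import Data.Sum using (inj₁; inj₂)
open import Data.Empty using (⊥-elim)
open import Relation.Binary.PropositionalEquality
  using (refl; sym; trans; cong; subst; module ≡-Reasoning)

open +-*-Solver using (solve; _:+_; _:*_; _:=_; con)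
open ≡-Reasoning

square-abs : ∀ y → y * y ≡ + (ℤ.∣ y ∣ ℕ.* ℤ.∣ y ∣)
square-abs (+ n)      = sym (ℤP.pos-* n n)
square-abs ℤ.-[1+ n ] = refl

square-difference : ∀ y A c → y * y ≡ + A - + c → ℤ.∣ y ∣ ℕ.* ℤ.∣ y ∣ ℕ.+ c ≡ A
square-difference y A c eq = ℤP.+-injective (begin
  + (ℤ.∣ y ∣ ℕ.* ℤ.∣ y ∣ ℕ.+ c)  ≡⟨ ℤP.pos-+ (ℤ.∣ y ∣ ℕ.* ℤ.∣ y ∣) c ⟩
  + (ℤ.∣ y ∣ ℕ.* ℤ.∣ y ∣) ℤ.+ + c ≡⟨ cong (ℤ._+ + c) (trans (sym (square-abs y)) eq) ⟩
  (+ A - + c) ℤ.+ + c             ≡⟨ //-rightDividesˡ (+ c) (+ A) ⟩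
  + A                              ∎)

even⇒double : ∀ n → parity n ≡ 0ℙ → ∃ λ e → n ≡ e ℕ.+ e
even⇒double zero          _    = 0 , refl
even⇒double (suc (suc n)) even with even⇒double n even
... | e , n≡e+e = suc e , cong suc (trans (cong suc n≡e+e) (sym (ℕP.+-suc e e)))

parity-gap : ∀ d b → parity (d ℕ.* (2 ℕ.* b ℕ.+ d)) ≡ parity d
parity-gap d b = begin
  parity (d ℕ.* (2 ℕ.* b ℕ.+ d))             ≡⟨ ℙP.*-homo-* d (2 ℕ.* b ℕ.+ d) ⟩
  p ℙ* parity (2 ℕ.* b ℕ.+ d)                ≡⟨ cong (p ℙ*_) (ℙP.+-homo-+ (2 ℕ.* b) d) ⟩
  p ℙ* (parity (2 ℕ.* b) ℙ+ p)               ≡⟨ cong (λ q → p ℙ* (q ℙ+ p)) (ℙP.*-homo-* 2 b) ⟩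
  p ℙ* (0ℙ ℙ+ p)                              ≡⟨ ℙP.*-idem p ⟩
  p                                           ∎
  where
    p : Parity
    p = parity d

smaller-prime-factor : ∀ {p} m n → Prime p → m ℕ.* n ≡ p → m ≤ n → m ≡ 1
smaller-prime-factor {p} m n pr mn≡p m≤n
  with prime⇒irreducible pr (divides n (trans (sym mn≡p) (ℕP.*-comm m n)))
... | inj₁ m≡1 = m≡1
... | inj₂ refl = ⊥-elim (not-below-2 (ℕP.≤-trans m≤n n≤1))
  where
    instance _ = prime⇒nonZero pr
    n≤1 : n ≤ 1
    n≤1 = ℕP.≤-reflexive (ℕP.*-cancelˡ-≡ n 1 m (trans mn≡p (sym (ℕP.*-identityʳ m))))
    not-below-2 : ¬ (m ≤ 1)
    not-below-2 z≤n       = ¬prime[0] pr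
    not-below-2 (s≤s z≤n) = ¬prime[1] pr

square-offset : ∀ b d k → (b ℕ.+ d) ℕ.* (b ℕ.+ d) ≡ b ℕ.* b ℕ.+ k → d ℕ.* (2 ℕ.* b ℕ.+ d) ≡ k
square-offset b d k eq = ℕP.+-cancelˡ-≡ (b ℕ.* b) _ _ (trans
  (solve 2 (λ b d → b :* b :+ d :* (con 2 :* b :+ d) := (b :+ d) :* (b :+ d)) refl b d)
  eq)

gap-lemma-offset : ∀ {ℓ} b d → Prime ℓ →
  (b ℕ.+ d) ℕ.* (b ℕ.+ d) ≡ b ℕ.* b ℕ.+ 4 ℕ.* ℓ → suc b ≡ ℓ
gap-lemma-offset {ℓ} b d pr eq = begin
  suc b              ≡⟨ ℕP.+-comm 1 b ⟩
  b ℕ.+ 1            ≡⟨ ℕP.*-identityˡ (b ℕ.+ 1) ⟨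
  1 ℕ.* (b ℕ.+ 1)    ≡⟨ cong (λ t → t ℕ.* (b ℕ.+ t)) e≡1 ⟨
  e ℕ.* (b ℕ.+ e)    ≡⟨ halved ⟩
  ℓ                  ∎
  where
    gap : d ℕ.* (2 ℕ.* b ℕ.+ d) ≡ 4 ℕ.* ℓ
    gap = square-offset b d (4 ℕ.* ℓ) eq
    d-even : parity d ≡ 0ℙ
    d-even = trans (sym (parity-gap d b)) (trans (cong parity gap) (ℙP.*-homo-* 4 ℓ))
    half : ∃ λ e → d ≡ e ℕ.+ e
    half = even⇒double d d-even
    e : ℕ
    e = proj₁ half
    halved : e ℕ.* (b ℕ.+ e) ≡ ℓ
    halved = ℕP.*-cancelˡ-≡ _ _ 4 (begin
      4 ℕ.* (e ℕ.* (b ℕ.+ e))              ≡⟨ solve 2 (λ e b → con 4 :* (e :* (b :+ e)) := (e :+ e) :* (con 2 :* b :+ (e :+ e))) refl e b ⟩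
      (e ℕ.+ e) ℕ.* (2 ℕ.* b ℕ.+ (e ℕ.+ e)) ≡⟨ cong (λ t → t ℕ.* (2 ℕ.* b ℕ.+ t)) (proj₂ half) ⟨
      d ℕ.* (2 ℕ.* b ℕ.+ d)                ≡⟨ gap ⟩
      4 ℕ.* ℓ                               ∎)
    e≡1 : e ≡ 1
    e≡1 = smaller-prime-factor e (b ℕ.+ e) pr halved (ℕP.m≤n+m e b)

n<n+multiple-of-prime : ∀ {ℓ} k n → .{{ℕ.NonZero k}} → Prime ℓ → n ℕ.< n ℕ.+ k ℕ.* ℓ
n<n+multiple-of-prime {ℓ} k n pr = ℕP.m<m+n n (ℕ.>-nonZero⁻¹ (k ℕ.* ℓ) {{ℕP.m*n≢0 k ℓ}})
  where instance _ = prime⇒nonZero pr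

gap-lemma : ∀ {ℓ} a b → Prime ℓ → a ℕ.* a ≡ b ℕ.* b ℕ.+ 4 ℕ.* ℓ → suc b ≡ ℓ
gap-lemma {ℓ} a b pr eq with ℕP.≤-total b a
... | inj₁ b≤a = gap-lemma-offset b (a ℕ.∸ b) pr
  (subst (λ t → t ℕ.* t ≡ b ℕ.* b ℕ.+ 4 ℕ.* ℓ) (sym (ℕP.m+[n∸m]≡n b≤a)) eq)
... | inj₂ a≤b = ⊥-elim (ℕP.<-irrefl eq
  (ℕP.≤-<-trans (ℕP.*-mono-≤ a≤b a≤b) (n<n+multiple-of-prime 4 (b ℕ.* b) pr)))

lemma4p17 : (A ℓ : ℕ) → Prime ℓ →
    ¬ (Σ ℤ λ x → Σ ℤ λ y → Σ ℤ λ z →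
         (x * x ≡ + A) × (y * y ≡ + A - + 4 * + ℓ) × (z * z ≡ + A - + 8 * + ℓ))
lemma4p17 A ℓ pr (x , y , z , x²≡A , y²≡A-4ℓ , z²≡A-8ℓ) =
  ℕP.<-irrefl c²≡c²+4ℓ (n<n+multiple-of-prime 4 (c ℕ.* c) pr)
  where
    a b c : ℕ
    a = ℤ.∣ x ∣
    b = ℤ.∣ y ∣
    c = ℤ.∣ z ∣
    shifted : ∀ w k → w * w ≡ + A - + k * + ℓ → ℤ.∣ w ∣ ℕ.* ℤ.∣ w ∣ ℕ.+ k ℕ.* ℓ ≡ A
    shifted w k eq = square-difference w A (k ℕ.* ℓ) (trans eq (cong (+ A -_) (sym (ℤP.pos-* k ℓ))))
    a²≡b²+4ℓ : a ℕ.* a ≡ b ℕ.* b ℕ.+ 4 ℕ.* ℓ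
    a²≡b²+4ℓ = trans (ℤP.+-injective (trans (sym (square-abs x)) x²≡A)) (sym (shifted y 4 y²≡A-4ℓ))
    b²≡c²+4ℓ : b ℕ.* b ≡ c ℕ.* c ℕ.+ 4 ℕ.* ℓ
    b²≡c²+4ℓ = ℕP.+-cancelʳ-≡ (4 ℕ.* ℓ) _ _ (begin
      b ℕ.* b ℕ.+ 4 ℕ.* ℓ                 ≡⟨ shifted y 4 y²≡A-4ℓ ⟩
      A                                     ≡⟨ shifted z 8 z²≡A-8ℓ ⟨
      c ℕ.* c ℕ.+ 8 ℕ.* ℓ                 ≡⟨ solve 2 (λ c l → c :* c :+ con 8 :* l := c :* c :+ con 4 :* l :+ con 4 :* l) refl c ℓ ⟩
      c ℕ.* c ℕ.+ 4 ℕ.* ℓ ℕ.+ 4 ℕ.* ℓ   ∎)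
    -- both b and c equal ℓ - 1 by the gap lemma
    b≡c : b ≡ c
    b≡c = ℕP.suc-injective (trans (gap-lemma a b pr a²≡b²+4ℓ) (sym (gap-lemma b c pr b²≡c²+4ℓ)))
    c²≡c²+4ℓ : c ℕ.* c ≡ c ℕ.* c ℕ.+ 4 ℕ.* ℓ
    c²≡c²+4ℓ = subst (λ t → t ℕ.* t ≡ c ℕ.* c ℕ.+ 4 ℕ.* ℓ) b≡c b²≡c²+4ℓ
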